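{- Let $\mathcal{C}$ be a left sum-generating class and let $\oplus_{\mathcal{C}}$ be defined by $A \oplus_{\mathcal{C}} B = B_L + A + B_R$, where $B_L$ is the longest initial segment of $B$ belonging to $\mathcal{C}$ and $B_R = B \setminus B_L$. Then $\oplus_{\mathcal{C}}$ is not commutative: there are linear orders $A, B$ with $A \oplus_{\mathcal{C}} B \not\cong B \oplus_{\mathcal{C}} A$.
   Context: A class $\mathcal{C}$ of linear orders is left sum-generating if: (i) it is closed under isomorphism; (ii) $A + B \in \mathcal{C}$ implies $B \in \mathcal{C}$; (iii) if $\beta$ is an ordinal and $A_\alpha \in \mathcal{C}$ for all $\alpha<\beta$, then $\sum_{\alpha<\beta} A_\alpha \in \mathcal{C}$. For such $\mathcal{C}$ every linear order has a longest (possibly empty) initial segment in $\mathcal{C}$. -}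

module Defs where

open import Level using (Level; 0ℓ)
open import Data.Product using (Σ; _,_; _×_; proj₁)
open import Data.Sum using (_⊎_; inj₁; inj₂)
open import Data.Unit using (⊤)
open import Data.Empty using (⊥)
open import Function using (_∘_)
open import Relation.Nullary using (¬_)
open import Relation.Binary.Bundles using (StrictTotalOrder)
open import Relation.Binary.Structures using (IsStrictTotalOrder)
open import Relation.Binary.PropositionalEquality using (_≡_)
open import Induction.WellFounded using (WellFounded)

LinOrd : Set₁
LinOrd = StrictTotalOrder 0ℓ 0ℓ 0ℓ

-- Raw ordered structures (carrier, equality, strict order), used to
-- describe sums / suborders without having to package their proofs.
record RawOrd : Set₁ where
  field
    Carrier : Set
    _≈_     : Carrier → Carrier → Set
    _<_     : Carrier → Carrier → Set

raw : LinOrd → RawOrd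
raw L = record
  { Carrier = StrictTotalOrder.Carrier L
  ; _≈_     = StrictTotalOrder._≈_ L
  ; _<_     = StrictTotalOrder._<_ L
  }

record _≅_ (R S : RawOrd) : Set where
  private
    module R = RawOrd R
    module S = RawOrd S
  field
    to        : R.Carrier → S.Carrier
    from      : S.Carrier → R.Carrier
    to-cong   : ∀ {x y} → x R.≈ y → to x S.≈ to y
    from-cong : ∀ {x y} → x S.≈ y → from x R.≈ from y
    from-to   : ∀ x → from (to x) R.≈ x
    to-from   : ∀ y → to (from y) S.≈ y
    to-mono   : ∀ {x y} → x R.< y → to x S.< to y
    from-mono : ∀ {x y} → x S.< y → from x R.< from y

_+ᴿ_ : RawOrd → RawOrd → RawOrd
R +ᴿ S = record { Carrier = R.Carrier ⊎ S.Carrier ; _≈_ = eq ; _<_ = lt }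
  where
  module R = RawOrd R
  module S = RawOrd S
  eq : R.Carrier ⊎ S.Carrier → R.Carrier ⊎ S.Carrier → Set
  eq (inj₁ a) (inj₁ b) = a R.≈ b
  eq (inj₁ a) (inj₂ b) = ⊥
  eq (inj₂ a) (inj₁ b) = ⊥
  eq (inj₂ a) (inj₂ b) = a S.≈ b
  lt : R.Carrier ⊎ S.Carrier → R.Carrier ⊎ S.Carrier → Set
  lt (inj₁ a) (inj₁ b) = a R.< b
  lt (inj₁ a) (inj₂ b) = ⊤
  lt (inj₂ a) (inj₁ b) = ⊥
  lt (inj₂ a) (inj₂ b) = a S.< b

record Ordinal : Set₁ where
  field
    Carrier : Set
    _<_     : Carrier → Carrier → Set
    isSTO   : IsStrictTotalOrder _≡_ _<_
    wf      : WellFounded _<_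

module _ (β : Ordinal) (A : Ordinal.Carrier β → RawOrd) where
  private
    module β = Ordinal β
    Car = Σ β.Carrier (λ α → RawOrd.Carrier (A α))

  data ΣEq : Car → Car → Set where
    same : ∀ {α a b} → RawOrd._≈_ (A α) a b → ΣEq (α , a) (α , b)

  data ΣLt : Car → Car → Set where
    fst< : ∀ {α α' a b} → α β.< α' → ΣLt (α , a) (α' , b)
    snd< : ∀ {α a b} → RawOrd._<_ (A α) a b → ΣLt (α , a) (α , b)

  ordSum : RawOrd
  ordSum = record { Carrier = Car ; _≈_ = ΣEq ; _<_ = ΣLt }

restrict : (R : RawOrd) → (RawOrd.Carrier R → Set) → RawOrd
restrict R P = record
  { Carrier = Σ (RawOrd.Carrier R) P
  ; _≈_     = λ x y → RawOrd._≈_ R (proj₁ x) (proj₁ y)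
  ; _<_     = λ x y → RawOrd._<_ R (proj₁ x) (proj₁ y)
  }

record LeftSumGenerating {ℓ : Level} (C : LinOrd → Set ℓ) : Set (Level.suc 0ℓ Level.⊔ ℓ) where
  field
    iso-closed : ∀ (X Y : LinOrd) → raw X ≅ raw Y → C X → C Y
    right-summand : ∀ (A B X : LinOrd) → raw X ≅ (raw A +ᴿ raw B) → C X → C B
    ordinal-sums : ∀ (β : Ordinal) (A : Ordinal.Carrier β → LinOrd) (X : LinOrd) →
                   raw X ≅ ordSum β (raw ∘ A) → (∀ α → C (A α)) → C X

IsInitialSegment : (B : LinOrd) → (StrictTotalOrder.Carrier B → Set) → Set
IsInitialSegment B P =
  (∀ {x y} → StrictTotalOrder._≈_ B x y → P x → P y) ×
  (∀ {x y} → StrictTotalOrder._<_ B y x → P x → P y)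

InClass : ∀ {ℓ} → (LinOrd → Set ℓ) → (B : LinOrd) → (StrictTotalOrder.Carrier B → Set) → Set (Level.suc 0ℓ Level.⊔ ℓ)
InClass C B P = Σ LinOrd (λ L → C L × (raw L ≅ restrict (raw B) P))

IsLongestInitialIn : ∀ {ℓ} → (LinOrd → Set ℓ) → (B : LinOrd) → (StrictTotalOrder.Carrier B → Set) → Set (Level.suc 0ℓ Level.⊔ ℓ)
IsLongestInitialIn C B P =
  IsInitialSegment B P × InClass C B P ×
  (∀ (Q : StrictTotalOrder.Carrier B → Set) → IsInitialSegment B Q → InClass C B Q →
     ∀ x → Q x → P x)

oplus : (A B : LinOrd) → (StrictTotalOrder.Carrier B → Set) → RawOrd
oplus A B P = (restrict (raw B) P +ᴿ raw A) +ᴿ restrict (raw B) (¬_ ∘ P)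

{-# OPTIONS --safe #-}
-- Either 𝟙 ∈ C or not; the goal is ⊥, so this case split is constructively harmless.
-- If 𝟙 ∈ C, then ω ∈ C as an ω-indexed sum of points, so 𝟙 ⊕ ω = ω + 1 has a
-- greatest element while ω ⊕ 𝟙 = 1 + ω has none.
-- If 𝟙 ∉ C, then no member of C has a greatest element x, since it would split as
-- (everything below x) + 𝟙 and 𝟙 is a right summand.  Every nonempty suborder of 𝟙
-- or of ω* has a greatest element, so both longest initial segments are empty, and
-- 𝟙 ⊕ ω* = 1 + ω* has a least element while ω* ⊕ 𝟙 = ω* + 1 has none.
module Submission where

open import Level using (Level)
open import Relation.Nullary using (¬_)
open import Relation.Binary.Bundles using (StrictTotalOrder)
open import Defs

open import Data.Empty using (⊥; ⊥-elim)
open import Data.Unit using (⊤; tt)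
open import Data.Product using (Σ-syntax; _,_; proj₁; proj₂)
open import Data.Sum using (_⊎_; inj₁; inj₂)
open import Data.Nat using (ℕ; suc) renaming (_<_ to _<ℕ_)
open import Data.Nat.Properties using (<-strictTotalOrder; <-isStrictTotalOrder; n<1+n)
open import Data.Nat.Induction using (<-wellFounded; <-rec)
open import Relation.Binary.PropositionalEquality using (_≡_; refl; isEquivalence)
open import Relation.Binary.Structures using (IsStrictTotalOrder)
open import Relation.Binary.Definitions using (tri<; tri≈; tri>)
import Relation.Binary.Construct.On as On
import Relation.Binary.Construct.Flip.Ord as Flip

subsingleton-isStrictTotalOrder : {A : Set} → (∀ (x y : A) → x ≡ y) →
                                  IsStrictTotalOrder {A = A} _≡_ (λ _ _ → ⊥)
subsingleton-isStrictTotalOrder all-equal = record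
  { isStrictPartialOrder = record
    { isEquivalence = isEquivalence
    ; irrefl        = λ _ ()
    ; trans         = λ ()
    ; <-resp-≈      = (λ _ ()) , (λ _ ())
    }
  ; compare = λ x y → tri≈ (λ ()) (all-equal x y) (λ ())
  }

𝟙 : LinOrd
𝟙 = record
  { Carrier            = ⊤
  ; _≈_                = _≡_
  ; _<_                = λ _ _ → ⊥
  ; isStrictTotalOrder = subsingleton-isStrictTotalOrder (λ _ _ → refl)
  }

ω : LinOrd
ω = <-strictTotalOrder

ω* : LinOrd
ω* = Flip.strictTotalOrder <-strictTotalOrder

∅-ordinal : Ordinal
∅-ordinal = record
  { Carrier = ⊥
  ; _<_     = λ _ _ → ⊥
  ; isSTO   = subsingleton-isStrictTotalOrder (λ ())
  ; wf      = λ ()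
  }

ω-ordinal : Ordinal
ω-ordinal = record
  { Carrier = ℕ
  ; _<_     = _<ℕ_
  ; isSTO   = <-isStrictTotalOrder
  ; wf      = <-wellFounded
  }

-- raw (Suborder X P) is definitionally restrict (raw X) P.
Suborder : (X : LinOrd) → (StrictTotalOrder.Carrier X → Set) → LinOrd
Suborder X P = On.strictTotalOrder X (proj₁ {B = P})

Below : (X : LinOrd) → StrictTotalOrder.Carrier X → LinOrd
Below X x = Suborder X (λ y → StrictTotalOrder._<_ X y x)

≅-refl : (X : LinOrd) → raw X ≅ raw X
≅-refl X = record
  { to        = λ x → x
  ; from      = λ x → x
  ; to-cong   = λ p → p
  ; from-cong = λ p → p
  ; from-to   = λ _ → Eq.refl
  ; to-from   = λ _ → Eq.refl
  ; to-mono   = λ p → p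
  ; from-mono = λ p → p
  }
  where open StrictTotalOrder X

≅-restrict-⊤ : (X : LinOrd) → raw X ≅ restrict (raw X) (λ _ → ⊤)
≅-restrict-⊤ X = record
  { to        = λ x → x , tt
  ; from      = proj₁
  ; to-cong   = λ p → p
  ; from-cong = λ p → p
  ; from-to   = λ _ → Eq.refl
  ; to-from   = λ _ → Eq.refl
  ; to-mono   = λ p → p
  ; from-mono = λ p → p
  }
  where open StrictTotalOrder X

module _ (X : LinOrd) (x : StrictTotalOrder.Carrier X)
         (x-greatest : ∀ y → ¬ StrictTotalOrder._<_ X x y) where
  open StrictTotalOrder X

  private
    Split : RawOrd
    Split = raw (Below X x) +ᴿ raw 𝟙

    module Split = RawOrd Split

    below-or-≈ : ∀ y → y < x ⊎ y ≈ x
    below-or-≈ y with compare y x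
    ... | tri< y<x _ _ = inj₁ y<x
    ... | tri≈ _ y≈x _ = inj₂ y≈x
    ... | tri> _ _ x<y = ⊥-elim (x-greatest y x<y)

    split : ∀ y → y < x ⊎ y ≈ x → Split.Carrier
    split y (inj₁ y<x) = inj₁ (y , y<x)
    split y (inj₂ _)   = inj₂ tt

    join : Split.Carrier → Carrier
    join (inj₁ (y , _)) = y
    join (inj₂ tt)      = x

    split-cong : ∀ {y z} → y ≈ z → ∀ c d → split y c Split.≈ split z d
    split-cong y≈z (inj₁ _)   (inj₁ _)   = y≈z
    split-cong y≈z (inj₁ y<x) (inj₂ z≈x) = ⊥-elim (irrefl (Eq.trans y≈z z≈x) y<x)
    split-cong y≈z (inj₂ y≈x) (inj₁ z<x) = ⊥-elim (irrefl (Eq.trans (Eq.sym y≈z) y≈x) z<x)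
    split-cong y≈z (inj₂ _)   (inj₂ _)   = refl

    join-cong : ∀ {s t} → s Split.≈ t → join s ≈ join t
    join-cong {inj₁ _}  {inj₁ _}  y≈z  = y≈z
    join-cong {inj₂ tt} {inj₂ tt} refl = Eq.refl

    join-split : ∀ y c → join (split y c) ≈ y
    join-split y (inj₁ _)   = Eq.refl
    join-split y (inj₂ y≈x) = Eq.sym y≈x

    split-join : ∀ s c → split (join s) c Split.≈ s
    split-join (inj₁ _)        (inj₁ _)   = Eq.refl
    split-join (inj₁ (_ , y<x)) (inj₂ y≈x) = ⊥-elim (irrefl y≈x y<x)
    split-join (inj₂ tt)       (inj₁ x<x) = ⊥-elim (irrefl Eq.refl x<x)
    split-join (inj₂ tt)       (inj₂ _)   = refl

    split-mono : ∀ {y z} → y < z → ∀ c d → split y c Split.< split z d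
    split-mono y<z (inj₁ _)   (inj₁ _)   = y<z
    split-mono y<z (inj₁ _)   (inj₂ _)   = tt
    split-mono y<z (inj₂ y≈x) (inj₁ z<x) = ⊥-elim (irrefl y≈x (trans y<z z<x))
    split-mono y<z (inj₂ y≈x) (inj₂ z≈x) = ⊥-elim (irrefl (Eq.trans y≈x (Eq.sym z≈x)) y<z)

    join-mono : ∀ {s t} → s Split.< t → join s < join t
    join-mono {inj₁ _}       {inj₁ _}  y<z = y<z
    join-mono {inj₁ (_ , y<x)} {inj₂ tt} _ = y<x
    join-mono {inj₂ tt}      {inj₁ _}  ()
    join-mono {inj₂ tt}      {inj₂ tt} ()

  split-greatest : raw X ≅ (raw (Below X x) +ᴿ raw 𝟙)
  split-greatest = record
    { to        = λ y → split y (below-or-≈ y)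
    ; from      = join
    ; to-cong   = λ {y} {z} y≈z → split-cong y≈z (below-or-≈ y) (below-or-≈ z)
    ; from-cong = λ {s} {t} → join-cong {s} {t}
    ; from-to   = λ y → join-split y (below-or-≈ y)
    ; to-from   = λ s → split-join s (below-or-≈ (join s))
    ; to-mono   = λ {y} {z} y<z → split-mono y<z (below-or-≈ y) (below-or-≈ z)
    ; from-mono = λ {s} {t} → join-mono {s} {t}
    }

module _ {ℓ : Level} {C : LinOrd → Set ℓ} (G : LeftSumGenerating C) where
  open LeftSumGenerating G

  empty∈C : (X : LinOrd) → ¬ StrictTotalOrder.Carrier X → C X
  empty∈C X empty = ordinal-sums ∅-ordinal (λ ()) X X≅∅ (λ ())
    where
    X≅∅ : raw X ≅ ordSum ∅-ordinal (λ ())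
    X≅∅ = record
      { to        = λ x → ⊥-elim (empty x)
      ; from      = λ { (() , _) }
      ; to-cong   = λ {x} → ⊥-elim (empty x)
      ; from-cong = λ { {() , _} }
      ; from-to   = λ x → ⊥-elim (empty x)
      ; to-from   = λ { (() , _) }
      ; to-mono   = λ {x} → ⊥-elim (empty x)
      ; from-mono = λ { {() , _} }
      }

  𝟙∈C⇒ω∈C : C 𝟙 → C ω
  𝟙∈C⇒ω∈C 𝟙∈C = ordinal-sums ω-ordinal (λ _ → 𝟙) ω ω≅Σ𝟙 (λ _ → 𝟙∈C)
    where
    ω≅Σ𝟙 : raw ω ≅ ordSum ω-ordinal (λ _ → raw 𝟙)
    ω≅Σ𝟙 = record
      { to        = λ n → n , tt
      ; from      = proj₁
      ; to-cong   = λ { refl → same refl }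
      ; from-cong = λ { (same _) → refl }
      ; from-to   = λ _ → refl
      ; to-from   = λ _ → same refl
      ; to-mono   = fst<
      ; from-mono = λ { (fst< m<n) → m<n ; (snd< ()) }
      }

  greatest⇒𝟙∈C : (X : LinOrd) → C X → (x : StrictTotalOrder.Carrier X) →
                 (∀ y → ¬ StrictTotalOrder._<_ X x y) → C 𝟙
  greatest⇒𝟙∈C X X∈C x x-greatest =
    right-summand (Below X x) 𝟙 X (split-greatest X x x-greatest) X∈C

  inClass-greatest⇒𝟙∈C : (B : LinOrd) {P : StrictTotalOrder.Carrier B → Set} →
                         InClass C B P → (x : StrictTotalOrder.Carrier B) → P x →
                         (∀ y → P y → ¬ StrictTotalOrder._<_ B x y) → C 𝟙
  inClass-greatest⇒𝟙∈C B {P} (L , L∈C , L≅P) x px x-greatest =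
    greatest⇒𝟙∈C (Suborder B P) (iso-closed L (Suborder B P) L≅P L∈C)
                 (x , px) (λ (y , py) → x-greatest y py)

  𝟙∉C⇒inClass-𝟙-empty : ¬ C 𝟙 → ∀ {P} → InClass C 𝟙 P → ∀ x → ¬ P x
  𝟙∉C⇒inClass-𝟙-empty 𝟙∉C P∈C tt p = 𝟙∉C (inClass-greatest⇒𝟙∈C 𝟙 P∈C tt p (λ _ _ ()))

  -- A nonempty P ⊆ ω* has a greatest element, its least natural number.
  𝟙∉C⇒inClass-ω*-empty : ¬ C 𝟙 → ∀ {P} → InClass C ω* P → ∀ n → ¬ P n
  𝟙∉C⇒inClass-ω*-empty 𝟙∉C {P} P∈C = <-rec (λ n → ¬ P n) λ n below-n pn →
    𝟙∉C (inClass-greatest⇒𝟙∈C ω* P∈C n pn (λ k pk k<n → below-n k<n pk))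

  ⊤-longest : (B : LinOrd) → C B → IsLongestInitialIn C B (λ _ → ⊤)
  ⊤-longest B B∈C =
    ((λ _ _ → tt) , (λ _ _ → tt)) , (B , B∈C , ≅-restrict-⊤ B) , (λ _ _ _ _ _ → tt)

  ⊥-longest : (B : LinOrd) → (∀ {P} → InClass C B P → ∀ x → ¬ P x) →
              IsLongestInitialIn C B (λ _ → ⊥)
  ⊥-longest B no-C-part =
    ((λ _ ()) , (λ _ ())) ,
    (Suborder B (λ _ → ⊥) , empty∈C _ proj₂ , ≅-refl (Suborder B (λ _ → ⊥))) ,
    (λ _ _ → no-C-part)

-- Stated up to ≈ because a RawOrd carries no congruence laws.
IsMaximum IsMinimum : (R : RawOrd) → RawOrd.Carrier R → Set
IsMaximum R x = ∀ a b → a ≈ x → ¬ a < b where open RawOrd R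
IsMinimum R x = ∀ a b → a ≈ x → ¬ b < a where open RawOrd R

NoMaximum NoMinimum : RawOrd → Set
NoMaximum R = ∀ a → Σ[ b ∈ Carrier ] a < b where open RawOrd R
NoMinimum R = ∀ a → Σ[ b ∈ Carrier ] b < a where open RawOrd R

≅-NoMaximum : ∀ {R S} → R ≅ S → NoMaximum S → ∀ {x} → ¬ IsMaximum R x
≅-NoMaximum R≅S no-max {x} x-max = let (b , x<b) = no-max (to x) in
  x-max (from (to x)) (from b) (from-to x) (from-mono x<b)
  where open _≅_ R≅S

≅-NoMinimum : ∀ {R S} → R ≅ S → NoMinimum S → ∀ {x} → ¬ IsMinimum R x
≅-NoMinimum R≅S no-min {x} x-min = let (b , b<x) = no-min (to x) in
  x-min (from (to x)) (from b) (from-to x) (from-mono b<x)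
  where open _≅_ R≅S

ω+1≇1+ω : ¬ (oplus 𝟙 ω (λ _ → ⊤) ≅ oplus ω 𝟙 (λ _ → ⊤))
ω+1≇1+ω iso = ≅-NoMaximum iso 1+ω-NoMaximum {inj₁ (inj₂ tt)} 1-IsMaximum
  where
  1-IsMaximum : IsMaximum (oplus 𝟙 ω (λ _ → ⊤)) (inj₁ (inj₂ tt))
  1-IsMaximum (inj₁ (inj₂ tt)) (inj₁ (inj₁ _))  _ ()
  1-IsMaximum (inj₁ (inj₂ tt)) (inj₁ (inj₂ tt)) _ ()
  1-IsMaximum (inj₁ (inj₂ tt)) (inj₂ (_ , ¬⊤))  _ _ = ¬⊤ tt
  1-IsMaximum (inj₁ (inj₁ _))  _ ()
  1-IsMaximum (inj₂ _)         _ ()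

  1+ω-NoMaximum : NoMaximum (oplus ω 𝟙 (λ _ → ⊤))
  1+ω-NoMaximum (inj₁ (inj₁ _))  = inj₁ (inj₂ 0) , tt
  1+ω-NoMaximum (inj₁ (inj₂ n))  = inj₁ (inj₂ (suc n)) , n<1+n n
  1+ω-NoMaximum (inj₂ (_ , ¬⊤)) = ⊥-elim (¬⊤ tt)

1+ω*≇ω*+1 : ¬ (oplus 𝟙 ω* (λ _ → ⊥) ≅ oplus ω* 𝟙 (λ _ → ⊥))
1+ω*≇ω*+1 iso = ≅-NoMinimum iso ω*+1-NoMinimum {inj₁ (inj₂ tt)} 1-IsMinimum
  where
  1-IsMinimum : IsMinimum (oplus 𝟙 ω* (λ _ → ⊥)) (inj₁ (inj₂ tt))
  1-IsMinimum (inj₁ (inj₂ tt))       (inj₁ (inj₁ (_ , ())))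
  1-IsMinimum (inj₁ (inj₂ tt))       (inj₁ (inj₂ tt)) _ ()
  1-IsMinimum (inj₁ (inj₂ tt))       (inj₂ _)         _ ()
  1-IsMinimum (inj₁ (inj₁ (_ , ()))) _
  1-IsMinimum (inj₂ _)               _                ()

  ω*+1-NoMinimum : NoMinimum (oplus ω* 𝟙 (λ _ → ⊥))
  ω*+1-NoMinimum (inj₁ (inj₁ (_ , ())))
  ω*+1-NoMinimum (inj₁ (inj₂ n)) = inj₁ (inj₂ (suc n)) , n<1+n n
  ω*+1-NoMinimum (inj₂ _)        = inj₁ (inj₂ 0) , tt

mainTheorem8 : ∀ {ℓ : Level} (C : LinOrd → Set ℓ) → LeftSumGenerating C →
    ¬ (∀ (A B : LinOrd)
         (P : StrictTotalOrder.Carrier B → Set) (Q : StrictTotalOrder.Carrier A → Set) →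
         IsLongestInitialIn C B P → IsLongestInitialIn C A Q →
         oplus A B P ≅ oplus B A Q)
mainTheorem8 C G ⊕-comm = 𝟙∉C-refuted 𝟙∈C-refuted
  where
  𝟙∈C-refuted : ¬ C 𝟙
  𝟙∈C-refuted 𝟙∈C =
    ω+1≇1+ω (⊕-comm 𝟙 ω _ _ (⊤-longest G ω (𝟙∈C⇒ω∈C G 𝟙∈C)) (⊤-longest G 𝟙 𝟙∈C))

  𝟙∉C-refuted : ¬ ¬ C 𝟙
  𝟙∉C-refuted 𝟙∉C =
    1+ω*≇ω*+1 (⊕-comm 𝟙 ω* _ _ (⊥-longest G ω* (𝟙∉C⇒inClass-ω*-empty G 𝟙∉C))
                                (⊥-longest G 𝟙 (𝟙∉C⇒inClass-𝟙-empty G 𝟙∉C)))
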